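{- For each integer $k>1$, every permutation of the positive integers contains an arithmetic progression of length $3$ whose common difference is not divisible by $k$.
   Context: A permutation of the positive integers is a sequence $p_1,p_2,\dots$ in which every positive integer appears exactly once. It contains an arithmetic progression of length $3$ with common difference $d$ if $d\neq 0$ (possibly negative) and there are indices $i_1<i_2<i_3$ and an integer $a$ with $p_{i_1}=a$, $p_{i_2}=a+d$ and $p_{i_3}=a+2d$. -}

module Defs where

open import Data.Nat using (ℕ; _<_; _≤_)
open import Data.Integer as ℤ using (ℤ; +_; _+_; _*_)
open import Data.Product using (Σ; _×_; ∃-syntax)
open import Relation.Binary.PropositionalEquality using (_≡_)
open import Relation.Nullary using (¬_)

-- A sequence p₁, p₂, … is modelled as p : ℕ → ℕ, of which only the values
-- at indices i ≥ 1 matter.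
record IsPermutationOfPositives (p : ℕ → ℕ) : Set where
  field
    positive   : ∀ i → 1 ≤ i → 1 ≤ p i
    injective  : ∀ i j → 1 ≤ i → 1 ≤ j → p i ≡ p j → i ≡ j
    surjective : ∀ n → 1 ≤ n → ∃[ i ] (1 ≤ i × p i ≡ n)

ContainsAP3 : (p : ℕ → ℕ) → ℤ → Set
ContainsAP3 p d =
  ¬ (d ≡ + 0) ×
  ∃[ i₁ ] ∃[ i₂ ] ∃[ i₃ ] ∃[ a ]
    (1 ≤ i₁ × i₁ < i₂ × i₂ < i₃ ×
     + (p i₁) ≡ a × + (p i₂) ≡ a + d × + (p i₃) ≡ a + + 2 * d)

module Submission where

-- Call an index i a *record* of p if p i exceeds every earlier
-- value p l (l < i).  If i is a record and j < i with p j < p i, put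
-- e = p i - p j > 0.  The value p i + e occurs somewhere, and it cannot occur
-- at an index ≤ i because every such value is ≤ p i; so it occurs at some
-- i₃ > i, and p j, p i, p i₃ is a 3-term progression with difference e.
--
-- For a permutation of the positive integers records occur beyond every
-- index: the first index whose value exceeds max(p 0, …, p N) is a record
-- lying beyond N.  Now let q be the index with p q = p 1 + 1 and take a
-- record i > q.  The two progressions obtained from j = 1 and j = q have
-- differences p i - p 1 and p i - p 1 - 1; these are consecutive integers,
-- so k > 1 cannot divide both.

open import Defs
open import Data.Nat using (ℕ; _<_)
open import Data.Integer using (ℤ; +_)
open import Data.Integer.Divisibility using (_∣_)
open import Data.Product using (_×_; ∃-syntax)
open import Relation.Nullary using (¬_)

open import Data.Nat as ℕ using (zero; suc; _≤_; _∸_; _⊔_; _+_; z≤n; s≤s; _<?_)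
open import Data.Nat.Properties
import Data.Nat.Divisibility as ℕᵈ
import Data.Integer as ℤ
import Data.Integer.Properties as ℤₚ
open import Data.Product using (_,_; proj₁; proj₂)
open import Data.Sum using (_⊎_; inj₁; inj₂; [_,_]′)
open import Relation.Nullary using (yes; no; contradiction)
open import Relation.Binary.PropositionalEquality

IsRecord : (ℕ → ℕ) → ℕ → Set
IsRecord p i = ∀ l → l < i → p l < p i

record-dominates : ∀ {p i l} → IsRecord p i → l ≤ i → p l ≤ p i
record-dominates {p} {i} {l} rec l≤i with m≤n⇒m<n∨m≡n l≤i
... | inj₁ l<i  = <⇒≤ (rec l l<i)
... | inj₂ refl = ≤-refl

middle-term : ∀ x y → y ≤ x → + x ≡ + y ℤ.+ + (x ∸ y)
middle-term x y y≤x = cong +_ (sym (m+[n∸m]≡n y≤x))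

last-term : ∀ x y → y ≤ x → + (x + (x ∸ y)) ≡ + y ℤ.+ + 2 ℤ.* + (x ∸ y)
last-term x y y≤x = begin
  + (x + e)           ≡⟨ cong (λ t → + (t + e)) (sym (m+[n∸m]≡n y≤x)) ⟩
  + (y + e + e)       ≡⟨ cong +_ (+-assoc y e e) ⟩
  + (y + (e + e))     ≡⟨ cong (λ t → + (y + (e + t))) (sym (+-identityʳ e)) ⟩
  + (y + 2 ℕ.* e)     ≡⟨ cong (ℤ._+_ (+ y)) (ℤₚ.pos-* 2 e) ⟩
  + y ℤ.+ + 2 ℤ.* + e ∎
  where
  open ≡-Reasoning
  e = x ∸ y

-- Key step: below a record i, every smaller earlier value p j starts a
-- 3-term progression p j, p i, p i₃ with difference p i - p j; the third
-- term p i + (p i - p j) must lie beyond i since i is a record.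
apFromRecord : ∀ {p} → IsPermutationOfPositives p → ∀ {j i} →
               1 ≤ j → j < i → p j < p i → IsRecord p i →
               ContainsAP3 p (+ (p i ∸ p j))
apFromRecord {p} P {j} {i} 1≤j j<i pj<pi rec =
  e≢0 , j , i , i₃ , + p j , 1≤j , j<i , i<i₃ , refl , middle , last
  where
  open IsPermutationOfPositives P
  e = p i ∸ p j
  0<e : 0 < e
  0<e = m<n⇒0<n∸m pj<pi
  e≢0 : ¬ (+ e ≡ + 0)
  e≢0 e≡0 = <⇒≢ 0<e (sym (ℤₚ.+-injective e≡0))
  third = surjective (p i + e) (≤-trans 0<e (m≤n+m e (p i)))
  i₃ = proj₁ third
  pi₃≡ : p i₃ ≡ p i + e
  pi₃≡ = proj₂ (proj₂ third)
  -- p i₃ > p i, whereas no index ≤ i carries a value above p i.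
  i<i₃ : i < i₃
  i<i₃ = ≰⇒> λ i₃≤i → <⇒≱ (m<m+n (p i) 0<e)
                        (subst (_≤ p i) pi₃≡ (record-dominates rec i₃≤i))
  middle : + p i ≡ + p j ℤ.+ + e
  middle = middle-term (p i) (p j) (<⇒≤ pj<pi)
  last : + p i₃ ≡ + p j ℤ.+ + 2 ℤ.* + e
  last = subst (λ v → + v ≡ + p j ℤ.+ + 2 ℤ.* + e) (sym pi₃≡)
           (last-term (p i) (p j) (<⇒≤ pj<pi))

maxUpTo : (ℕ → ℕ) → ℕ → ℕ
maxUpTo p zero    = p zero
maxUpTo p (suc n) = maxUpTo p n ⊔ p (suc n)

≤-maxUpTo : ∀ p {n l} → l ≤ n → p l ≤ maxUpTo p n
≤-maxUpTo p {zero}  z≤n = ≤-refl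
≤-maxUpTo p {suc n} l≤1+n with m≤n⇒m<n∨m≡n l≤1+n
... | inj₁ l<1+n = ≤-trans (≤-maxUpTo p (≤-pred l<1+n)) (m≤m⊔n _ _)
... | inj₂ refl  = m≤n⊔m (maxUpTo p n) (p (suc n))

FirstAbove : (ℕ → ℕ) → ℕ → Set
FirstAbove p M = ∃[ i ] (M < p i × (∀ l → l < i → p l ≤ M))

searchAbove : ∀ p M n → (∀ l → l < n → p l ≤ M) ⊎ FirstAbove p M
searchAbove p M zero = inj₁ λ _ ()
searchAbove p M (suc n) with searchAbove p M n
... | inj₂ first = inj₂ first
... | inj₁ below with M <? p n
...   | yes above    = inj₂ (n , above , below)
...   | no notAbove  = inj₁ λ l l<1+n →
          [ below l , (λ { refl → ≮⇒≥ notAbove }) ]′ (m≤n⇒m<n∨m≡n (≤-pred l<1+n))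

firstAbove : ∀ p M {r} → M < p r → FirstAbove p M
firstAbove p M {r} M<pr with searchAbove p M (suc r)
... | inj₂ first = first
... | inj₁ below = contradiction (below r ≤-refl) (<⇒≱ M<pr)

-- An unbounded sequence has records beyond every index N: the first index
-- exceeding max(p 0, …, p N) is one.
recordBeyond : ∀ p → (∀ M → ∃[ r ] (M < p r)) → ∀ N → ∃[ i ] (N < i × IsRecord p i)
recordBeyond p unbounded N with unbounded (maxUpTo p N)
... | r , M<pr with firstAbove p (maxUpTo p N) M<pr
...   | i , M<pi , below =
          i , (≰⇒> λ i≤N → <⇒≱ M<pi (≤-maxUpTo p i≤N))
        , (λ l l<i → ≤-<-trans (below l l<i) M<pi)

unbounded : ∀ {p} → IsPermutationOfPositives p → ∀ M → ∃[ r ] (M < p r)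
unbounded P M with IsPermutationOfPositives.surjective P (suc M) (s≤s z≤n)
... | r , _ , pr≡1+M = r , subst (M <_) (sym pr≡1+M) ≤-refl

¬∣-consecutive : ∀ {k n} → 1 < k → k ℕᵈ.∣ n → ¬ (k ℕᵈ.∣ suc n)
¬∣-consecutive {k} {n} 1<k k∣n k∣1+n =
  <⇒≢ 1<k (sym (ℕᵈ.∣1⇒≡1 (ℕᵈ.∣m+n∣m⇒∣n (subst (k ℕᵈ.∣_) (+-comm 1 n) k∣1+n) k∣n)))

mainTheorem5 : ∀ (k : ℕ) → 1 < k → (p : ℕ → ℕ) → IsPermutationOfPositives p →
    ∃[ d ] (ContainsAP3 p d × ¬ ((+ k) ∣ d))
mainTheorem5 k 1<k p P
  with IsPermutationOfPositives.surjective P (suc (p 1)) (s≤s z≤n)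
... | q , 1≤q , pq≡1+p1 with recordBeyond p (unbounded P) q
...   | i , q<i , rec with k ℕᵈ.∣? (p i ∸ p 1)
...     | no  k∤gap₁ = _ , apFromRecord P ≤-refl 1<i (rec 1 1<i) rec , k∤gap₁
  where 1<i = ≤-<-trans 1≤q q<i
...     | yes k∣gap₁ = _ , apFromRecord P 1≤q q<i (rec q q<i) rec , k∤gapq
  where
  gap₁≡1+gapq : p i ∸ p 1 ≡ suc (p i ∸ p q)
  gap₁≡1+gapq = subst (λ v → p i ∸ p 1 ≡ suc (p i ∸ v)) (sym pq≡1+p1)
                  (+-∸-assoc 1 (subst (_≤ p i) pq≡1+p1 (<⇒≤ (rec q q<i))))
  k∤gapq : ¬ (k ℕᵈ.∣ (p i ∸ p q))
  k∤gapq k∣gapq = ¬∣-consecutive 1<k k∣gapq (subst (k ℕᵈ.∣_) gap₁≡1+gapq k∣gap₁)
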